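{- Let $\Sigma_M$ be a matroidal fan in $\mathbb{R}^n$, let $X=\Sigma_M\times\mathbb{T}^r$, and let $\sigma$ be a face of $\Sigma_M$. For subsets $I\subseteq J\subseteq[r]$, consider the faces $\sigma\times\mathbb{T}^r_I$ and $\sigma\times\mathbb{T}^r_J$ of $X$. Then $$w_{\mathrm{csm}_k(X)}(\sigma\times\mathbb{T}^r_I)=w_{\mathrm{csm}_{k+|I|-|J|}(X)}(\sigma\times\mathbb{T}^r_J).$$
   Context: $\mathbb{T}=\mathbb{R}\cup\{ -\infty\}$, and $\mathbb{T}^r_I=\{x\in\mathbb{T}^r:x_i=-\infty\iff i\in I\}\cong\mathbb{R}^{r-|I|}$. A matroidal fan $\Sigma_M$ is the Bergman fan of a loopless matroid $M$ (image in $\mathbb{R}^{N+1}/\mathbb{R}\mathbf 1$ of the fan with cones $-\mathrm{cone}(e_{F_1},\dots,e_{F_k})+\mathbb{R}\mathbf 1$ over chains of flats) with weights $1$. For a loopless matroid $N$ of rank $d+1$, $\mathrm{csm}_k(N)$ is supported on the $k$-skeleton of its Bergman fan, the cone of a chain $\emptyset=F_0\subsetneq\dots\subsetneq F_{k+1}=E$ having weight $(-1)^{d-k}\prod_{i=0}^k\beta(N|F_{i+1}/F_i)$ ($\beta$ beta invariant). The CSM cycles of $X$ are $\mathrm{csm}_k(\Sigma_M\times\mathbb{T}^r)=\sum_{I\subseteq[r]}\overline{\mathrm{csm}_k(\Sigma_M\times\mathbb{T}^r_I)}$, where $\Sigma_M\times\mathbb{T}^r_I\cong\Sigma_M\times\mathbb{R}^{r-|I|}$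 is the matroidal fan of $M$ direct sum $r-|I|$ coloops; $w_{\mathrm{csm}_k(X)}(\tau)$ denotes the weight of the face $\tau$ in $\mathrm{csm}_k(X)$ (taken to be $0$ if $\tau$ is not $k$-dimensional). -}

module Defs where

open import Data.Nat using (ℕ; zero; suc; _≤_; _<_; _∸_) renaming (_+_ to _+ℕ_)
open import Data.Integer using (ℤ; +_; _*_; _-_; -_; 0ℤ; 1ℤ) renaming (_+_ to _+ℤ_)
import Data.Integer as ℤ
open import Data.Fin using (Fin)
open import Data.Fin.Subset using (Subset; ⊥; ⊤; ⁅_⁆; _∈_; _∉_; _⊆_; _⊂_; _∪_; _∩_; _─_; ∣_∣; inside; outside)
open import Data.Vec using (Vec; []; _∷_; take; drop)
open import Data.List using (List; []; _∷_; _++_; map; foldr; length)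
open import Data.List.Relation.Unary.All using (All)
open import Data.List.Relation.Unary.Any using (Any)
open import Data.List.Relation.Unary.Linked using (Linked)
open import Data.Product using (_×_)
open import Data.Sum using (_⊎_)
open import Relation.Binary.PropositionalEquality using (_≡_)
open import Relation.Nullary using (yes; no)

RankFn : ℕ → Set
RankFn n = Subset n → ℕ

record IsMatroid {n : ℕ} (ρ : RankFn n) : Set where
  field
    bounded    : ∀ A → ρ A ≤ ∣ A ∣
    monotone   : ∀ A B → A ⊆ B → ρ A ≤ ρ B
    submodular : ∀ A B → ρ (A ∪ B) +ℕ ρ (A ∩ B) ≤ ρ A +ℕ ρ B

Loopless : {n : ℕ} → RankFn n → Set
Loopless {n} ρ = (i : Fin n) → ρ ⁅ i ⁆ ≡ 1

IsFlat : {n : ℕ} → RankFn n → Subset n → Set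
IsFlat {n} ρ A = (i : Fin n) → i ∉ A → ρ A < ρ (A ∪ ⁅ i ⁆)

-- A chain F₁ ⊊ … ⊊ Fₛ of proper nonempty flats; it indexes the cone
-- -cone(e_{F₁},…,e_{Fₛ}) + ℝ𝟏 of the Bergman fan (a face of dimension s).
IsChainOfFlats : {n : ℕ} → RankFn n → List (Subset n) → Set
IsChainOfFlats ρ τ = All (λ F → IsFlat ρ F × ⊥ ⊂ F × F ⊂ ⊤) τ × Linked _⊂_ τ

sgn : ℕ → ℤ
sgn zero = 1ℤ
sgn (suc k) = - sgn k

sumℤ : List ℤ → ℤ
sumℤ = foldr _+ℤ_ 0ℤ

subsetsOf : {n : ℕ} → Subset n → List (Subset n)
subsetsOf [] = [] ∷ []
subsetsOf (outside ∷ s) = map (outside ∷_) (subsetsOf s)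
subsetsOf (inside ∷ s) = map (outside ∷_) (subsetsOf s) ++ map (inside ∷_) (subsetsOf s)

-- beta invariant of the minor N|G/F (ground set G ∖ F, rank A ↦ ρ(A ∪ F) - ρ F):
-- β = (-1)^{rk} Σ_{A ⊆ G∖F} (-1)^{|A|} rk(A)     (Crapo)
betaMinor : {n : ℕ} → RankFn n → Subset n → Subset n → ℤ
betaMinor ρ F G =
  sgn (ρ G ∸ ρ F) * sumℤ (map (λ A → sgn ∣ A ∣ * (+ ρ (A ∪ F) - + ρ F)) (subsetsOf (G ─ F)))

prodBeta : {n : ℕ} → RankFn n → List (Subset n) → ℤ
prodBeta ρ [] = 1ℤ
prodBeta ρ (F ∷ []) = 1ℤ
prodBeta ρ (F ∷ G ∷ l) = betaMinor ρ F G * prodBeta ρ (G ∷ l)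

-- weight of the cone of the chain τ in csm_k of the matroid with rank ρ
-- (rank d+1 = ρ ⊤): (-1)^{d-k} ∏_{i=0}^{k} β(N|F_{i+1}/F_i) if dim τ = k, else 0.
-- (-1)^{d-k} = (-1)^{d+k}.
csmWeight : {n : ℕ} → RankFn n → ℤ → List (Subset n) → ℤ
csmWeight ρ k τ with + length τ ℤ.≟ k
... | yes _ = sgn ((ρ ⊤ ∸ 1) +ℕ length τ) * prodBeta ρ (⊥ ∷ τ ++ ⊤ ∷ [])
... | no _  = 0ℤ

-- M ⊕ (m coloops), ground set Fin (suc n) ⊔ {m new elements} = Fin (suc n + m)
withColoops : {n : ℕ} → RankFn (suc n) → (m : ℕ) → RankFn (suc n +ℕ m)
withColoops {n} ρ m A = ρ (take (suc n) A) +ℕ ∣ drop (suc n) A ∣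

-- τ is a fine cone (chain of flats of M ⊕ m coloops) of full dimension dim σ + m
-- inside the face σ × ℝ^m of Σ_M × ℝ^m ≅ Σ_{M ⊕ m coloops}, i.e. its
-- projection to ℝ^E/ℝ𝟏 lies in σ: each G ∩ E is ∅, E, or a flat of the chain σ.
FineConeIn : {n : ℕ} → RankFn (suc n) → (m : ℕ) → List (Subset (suc n)) →
             List (Subset (suc n +ℕ m)) → Set
FineConeIn {n} ρ m σ τ =
  IsChainOfFlats (withColoops ρ m) τ × length τ ≡ length σ +ℕ m ×
  All (λ G → (take (suc n) G ≡ ⊥ ⊎ take (suc n) G ≡ ⊤) ⊎ Any (take (suc n) G ≡_) σ) τ

-- w_{csm_k(X)}(σ × 𝕋^r_I), X = Σ_M × 𝕋^r, evaluated on a fine cone τ of the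
-- face σ × 𝕋^r_I ≅ σ × ℝ^{r-|I|} (only the stratum 𝕋^r_I contributes k-dimensional
-- weight there).
wCsmX : {n : ℕ} → RankFn (suc n) → (r : ℕ) → ℤ → (I : Subset r) →
        List (Subset (suc n +ℕ (r ∸ ∣ I ∣))) → ℤ
wCsmX ρ r k I τ = csmWeight (withColoops ρ (r ∸ ∣ I ∣)) k τ

{-# OPTIONS --safe #-}
module Submission where

-- On the face σ × 𝕋ʳ_I only the stratum Σ_M × 𝕋ʳ_I ≅ Σ_{M ⊕ m coloops},
-- m = r - |I|, contributes. A full-dimensional chain τ of M ⊕ m coloops inside
-- σ × ℝᵐ refines the chain σ, and counting steps shows that each step either adds a
-- single coloop (a minor with β = 1) or passes to the next flat of σ keeping the
-- coloops (a minor with the β of the corresponding minor of M). Hence the weight of τ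
-- in csm_k(M ⊕ m coloops) is the weight of σ in csm_{k-m}(M), the sign changing by
-- (-1)^{2m}, and both sides of the identity are the weight of σ in csm_{k+|I|-r}(M).

open import Defs
open import Data.Nat using (ℕ; suc; _∸_) renaming (_+_ to _+ℕ_)
open import Data.Integer using (ℤ; +_; _+_; _-_)
open import Data.Fin.Subset using (Subset; _⊆_; ∣_∣)
open import Data.List using (List)
open import Relation.Binary.PropositionalEquality using (_≡_)

open import Data.Empty using (⊥-elim)
open import Data.Fin.Subset using (⊥; ⊤; ⁅_⁆; _⊂_; _∪_; _─_; inside; outside)
open import Data.Fin using (zero)
open import Data.Fin.Subset.Properties
  using (drop-∷-⊆; ⊆⊤; ⊥⊆; ∈⊤; ∉⊥; ∣⊥∣≡0; ∣⊤∣≡n; ∣p∣≤n; ∪-identityˡ;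
         p⊆q⇒∣p∣≤∣q∣; p⊂q⇒∣p∣<∣q∣; p⊂q⇒p⊆q; ⊂-trans; ⊂-⊆-trans; ⊂-irref)
open import Data.Integer using (_*_; -_; 1ℤ)
import Data.Integer as ℤ
import Data.Integer.Properties as ℤ
import Data.Integer.Tactic.RingSolver as ℤ-Solver
open import Data.List using ([]; _∷_; length; map)
import Data.List as List
open import Data.List.Properties using (length-++; map-∘; map-++; map-cong)
open import Data.List.Membership.Propositional using (_∈_)
open import Data.List.Membership.Propositional.Properties using (∈-++⁺ʳ; ∈-++⁺ˡ)
open import Data.List.Relation.Unary.All using (All; []; _∷_)
import Data.List.Relation.Unary.All as All
import Data.List.Relation.Unary.All.Properties as All
open import Data.List.Relation.Unary.Any using (here; there)
open import Data.List.Relation.Unary.Linked using (Linked; []; [-]; _∷_)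
import Data.List.Relation.Unary.Linked as Linked
open import Data.List.Relation.Unary.Linked.Properties using (Linked⇒All)
open import Data.Nat using (zero; _≤_; _<_; s≤s)
open import Data.Nat.Properties
import Data.Nat.Tactic.RingSolver as ℕ-Solver
open import Data.Product using (_×_; _,_; proj₁; proj₂)
open import Data.Sum using (_⊎_; inj₁; inj₂)
open import Data.Vec using (Vec; []; _∷_; _++_; take; drop; replicate)
open import Data.Vec.Properties using (take++drop≡id; ++-injective; zipWith-++)
open import Function using (_∘_)
open import Relation.Binary.PropositionalEquality using (refl; sym; trans; cong; cong₂; subst; module ≡-Reasoning)
open import Relation.Nullary using (yes; no; contradiction)

open Data.Vec._[_]=_

≤-squeeze : {x y z : ℕ} → x ≤ y → y ≤ z → x ≡ z → x ≡ y × y ≡ z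
≤-squeeze x≤y y≤z refl = ≤-antisym x≤y y≤z , ≤-antisym y≤z x≤y

sgn-double+ : ∀ m x → sgn (m +ℕ m +ℕ x) ≡ sgn x
sgn-double+ zero    x = refl
sgn-double+ (suc m) x = begin
  - sgn (m +ℕ suc m +ℕ x)   ≡⟨ cong (λ e → - sgn (e +ℕ x)) (+-suc m m) ⟩
  - - sgn (m +ℕ m +ℕ x)     ≡⟨ ℤ.neg-involutive _ ⟩
  sgn (m +ℕ m +ℕ x)         ≡⟨ sgn-double+ m x ⟩
  sgn x                     ∎
  where open ≡-Reasoning

+[m+n]≡k⇒+m≡k-+n : ∀ {m n} {k : ℤ} → + (m +ℕ n) ≡ k → + m ≡ k - + n
+[m+n]≡k⇒+m≡k-+n {m} {n} refl = trans (identity (+ m) (+ n)) (cong (_- + n) (sym (ℤ.pos-+ m n)))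
  where
  identity : ∀ a b → a ≡ a + b - b
  identity = ℤ-Solver.solve-∀

+m≡k-+n⇒+[m+n]≡k : ∀ {m n} {k : ℤ} → + m ≡ k - + n → + (m +ℕ n) ≡ k
+m≡k-+n⇒+[m+n]≡k {m} {n} {k} e = trans (ℤ.pos-+ m n) (trans (cong (_+ + n) e) (identity k (+ n)))
  where
  identity : ∀ c b → c - b + b ≡ c
  identity = ℤ-Solver.solve-∀

+[m∸n]≡+m-+n : {m n : ℕ} → n ≤ m → + (m ∸ n) ≡ + m - + n
+[m∸n]≡+m-+n {m} {n} n≤m = trans (sym (ℤ.⊖-≥ n≤m)) (sym (ℤ.[+m]-[+n]≡m⊖n m n))

replicate-++ : ∀ {A : Set} k {m} (x : A) → replicate (k +ℕ m) x ≡ replicate k x ++ replicate m x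
replicate-++ zero    x = refl
replicate-++ (suc k) x = cong (x ∷_) (replicate-++ k x)

module _ {A : Set} {k m : ℕ} (a : Vec A k) (b : Vec A m) where

  take-++ : take k (a ++ b) ≡ a
  take-++ = proj₁ (++-injective (take k (a ++ b)) a (take++drop≡id k (a ++ b)))

  drop-++ : drop k (a ++ b) ≡ b
  drop-++ = proj₂ (++-injective (take k (a ++ b)) a (take++drop≡id k (a ++ b)))

take-⊥ : ∀ k {m} → take k (⊥ {k +ℕ m}) ≡ ⊥
take-⊥ k {m} = trans (cong (take k) (replicate-++ k outside)) (take-++ (⊥ {k}) (⊥ {m}))

drop-⊥ : ∀ k {m} → drop k (⊥ {k +ℕ m}) ≡ ⊥
drop-⊥ k {m} = trans (cong (drop k) (replicate-++ k outside)) (drop-++ (⊥ {k}) (⊥ {m}))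

take-⊤ : ∀ k {m} → take k (⊤ {k +ℕ m}) ≡ ⊤
take-⊤ k {m} = trans (cong (take k) (replicate-++ k inside)) (take-++ (⊤ {k}) (⊤ {m}))

drop-⊤ : ∀ k {m} → drop k (⊤ {k +ℕ m}) ≡ ⊤
drop-⊤ k {m} = trans (cong (drop k) (replicate-++ k inside)) (drop-++ (⊤ {k}) (⊤ {m}))

∣take∣+∣drop∣ : ∀ k {m} (X : Subset (k +ℕ m)) → ∣ take k X ∣ +ℕ ∣ drop k X ∣ ≡ ∣ X ∣
∣take∣+∣drop∣ zero    X             = refl
∣take∣+∣drop∣ (suc k) (outside ∷ X) = ∣take∣+∣drop∣ k X
∣take∣+∣drop∣ (suc k) (inside ∷ X)  = cong suc (∣take∣+∣drop∣ k X)

take-⊆ : ∀ k {m} {F G : Subset (k +ℕ m)} → F ⊆ G → take k F ⊆ take k G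
take-⊆ (suc k) {F = _ ∷ F} {_ ∷ G} F⊆G here with F⊆G here
... | here = here
take-⊆ (suc k) {F = _ ∷ F} {_ ∷ G} F⊆G (there x∈F) = there (take-⊆ k (drop-∷-⊆ F⊆G) x∈F)

drop-⊆ : ∀ k {m} {F G : Subset (k +ℕ m)} → F ⊆ G → drop k F ⊆ drop k G
drop-⊆ zero    F⊆G = F⊆G
drop-⊆ (suc k) {F = _ ∷ F} {_ ∷ G} F⊆G = drop-⊆ k (drop-∷-⊆ F⊆G)

take≡⇒⊂⇒∣drop∣<∣drop∣ : ∀ k {m} {F G : Subset (k +ℕ m)} → take k F ≡ take k G → F ⊂ G →
                         ∣ drop k F ∣ < ∣ drop k G ∣
take≡⇒⊂⇒∣drop∣<∣drop∣ k {F = F} {G} tF≡tG F⊂G = +-cancelˡ-< ∣ take k F ∣ _ _ (begin-strict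
  ∣ take k F ∣ +ℕ ∣ drop k F ∣ ≡⟨ ∣take∣+∣drop∣ k F ⟩
  ∣ F ∣                       <⟨ p⊂q⇒∣p∣<∣q∣ F⊂G ⟩
  ∣ G ∣                       ≡⟨ sym (∣take∣+∣drop∣ k G) ⟩
  ∣ take k G ∣ +ℕ ∣ drop k G ∣ ≡⟨ cong (λ X → ∣ X ∣ +ℕ ∣ drop k G ∣) (sym tF≡tG) ⟩
  ∣ take k F ∣ +ℕ ∣ drop k G ∣ ∎)
  where open ≤-Reasoning

p⊆q⇒∣p∣≡∣q∣⇒p≡q : ∀ {k} {p q : Subset k} → p ⊆ q → ∣ p ∣ ≡ ∣ q ∣ → p ≡ q
p⊆q⇒∣p∣≡∣q∣⇒p≡q {p = []}          {[]}          _   _ = refl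
p⊆q⇒∣p∣≡∣q∣⇒p≡q {p = inside ∷ p}  {inside ∷ q}  p⊆q e =
  cong (inside ∷_) (p⊆q⇒∣p∣≡∣q∣⇒p≡q (drop-∷-⊆ p⊆q) (suc-injective e))
p⊆q⇒∣p∣≡∣q∣⇒p≡q {p = outside ∷ p} {outside ∷ q} p⊆q e =
  cong (outside ∷_) (p⊆q⇒∣p∣≡∣q∣⇒p≡q (drop-∷-⊆ p⊆q) e)
p⊆q⇒∣p∣≡∣q∣⇒p≡q {p = inside ∷ p}  {outside ∷ q} p⊆q e with p⊆q here
... | ()
p⊆q⇒∣p∣≡∣q∣⇒p≡q {p = outside ∷ p} {inside ∷ q}  p⊆q e =
  contradiction (p⊆q⇒∣p∣≤∣q∣ (drop-∷-⊆ p⊆q)) (<⇒≱ (≤-reflexive (sym e)))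

p⊆q⇒∣q─p∣+∣p∣≡∣q∣ : ∀ {k} {p q : Subset k} → p ⊆ q → ∣ q ─ p ∣ +ℕ ∣ p ∣ ≡ ∣ q ∣
p⊆q⇒∣q─p∣+∣p∣≡∣q∣ {p = []}          {[]}          _   = refl
p⊆q⇒∣q─p∣+∣p∣≡∣q∣ {p = inside ∷ p}  {inside ∷ q}  p⊆q =
  trans (+-suc _ _) (cong suc (p⊆q⇒∣q─p∣+∣p∣≡∣q∣ (drop-∷-⊆ p⊆q)))
p⊆q⇒∣q─p∣+∣p∣≡∣q∣ {p = outside ∷ p} {inside ∷ q}  p⊆q = cong suc (p⊆q⇒∣q─p∣+∣p∣≡∣q∣ (drop-∷-⊆ p⊆q))
p⊆q⇒∣q─p∣+∣p∣≡∣q∣ {p = outside ∷ p} {outside ∷ q} p⊆q = p⊆q⇒∣q─p∣+∣p∣≡∣q∣ (drop-∷-⊆ p⊆q)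
p⊆q⇒∣q─p∣+∣p∣≡∣q∣ {p = inside ∷ p}  {outside ∷ q} p⊆q with p⊆q here
... | ()

p⊆q⇒[q─p]∪p≡q : ∀ {k} {p q : Subset k} → p ⊆ q → (q ─ p) ∪ p ≡ q
p⊆q⇒[q─p]∪p≡q {p = []}          {[]}          _   = refl
p⊆q⇒[q─p]∪p≡q {p = inside ∷ p}  {inside ∷ q}  p⊆q = cong (inside ∷_) (p⊆q⇒[q─p]∪p≡q (drop-∷-⊆ p⊆q))
p⊆q⇒[q─p]∪p≡q {p = outside ∷ p} {inside ∷ q}  p⊆q = cong (inside ∷_) (p⊆q⇒[q─p]∪p≡q (drop-∷-⊆ p⊆q))
p⊆q⇒[q─p]∪p≡q {p = outside ∷ p} {outside ∷ q} p⊆q = cong (outside ∷_) (p⊆q⇒[q─p]∪p≡q (drop-∷-⊆ p⊆q))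
p⊆q⇒[q─p]∪p≡q {p = inside ∷ p}  {outside ∷ q} p⊆q with p⊆q here
... | ()

p─p≡⊥ : ∀ {k} (p : Subset k) → p ─ p ≡ ⊥
p─p≡⊥ []            = refl
p─p≡⊥ (inside ∷ p)  = cong (outside ∷_) (p─p≡⊥ p)
p─p≡⊥ (outside ∷ p) = cong (outside ∷_) (p─p≡⊥ p)

∣p∣≡0⇒p≡⊥ : ∀ {k} (p : Subset k) → ∣ p ∣ ≡ 0 → p ≡ ⊥
∣p∣≡0⇒p≡⊥ []            _ = refl
∣p∣≡0⇒p≡⊥ (outside ∷ p) e = cong (outside ∷_) (∣p∣≡0⇒p≡⊥ p e)

subsetsOf-⊥ : ∀ k → subsetsOf (⊥ {k}) ≡ ⊥ ∷ []
subsetsOf-⊥ zero    = refl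
subsetsOf-⊥ (suc k) = cong (map (outside ∷_)) (subsetsOf-⊥ k)

subsetsOf-singleton : ∀ {k} (D : Subset k) → ∣ D ∣ ≡ 1 → subsetsOf D ≡ ⊥ ∷ D ∷ []
subsetsOf-singleton (outside ∷ D) e = cong (map (outside ∷_)) (subsetsOf-singleton D e)
subsetsOf-singleton {suc k} (inside ∷ D) e
  rewrite ∣p∣≡0⇒p≡⊥ D (suc-injective e) | subsetsOf-⊥ k = refl

map-∷-++ : ∀ {k m} s (Ds : List (Subset k)) (b : Subset m) →
           map (s ∷_) (map (_++ b) Ds) ≡ map (_++ b) (map (s ∷_) Ds)
map-∷-++ s Ds b = trans (sym (map-∘ Ds)) (map-∘ Ds)

subsetsOf-++⊥ : ∀ {k} m (D : Subset k) → subsetsOf (D ++ ⊥ {m}) ≡ map (_++ ⊥) (subsetsOf D)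
subsetsOf-++⊥ m []            = subsetsOf-⊥ m
subsetsOf-++⊥ m (outside ∷ D) =
  trans (cong (map (outside ∷_)) (subsetsOf-++⊥ m D)) (map-∷-++ outside (subsetsOf D) ⊥)
subsetsOf-++⊥ m (inside ∷ D)  = begin
  map (outside ∷_) (subsetsOf (D ++ ⊥)) List.++ map (inside ∷_) (subsetsOf (D ++ ⊥))
    ≡⟨ cong₂ List._++_ (cons outside) (cons inside) ⟩
  map (_++ ⊥) (map (outside ∷_) (subsetsOf D)) List.++ map (_++ ⊥) (map (inside ∷_) (subsetsOf D))
    ≡⟨ sym (map-++ (_++ ⊥) (map (outside ∷_) (subsetsOf D)) _) ⟩
  map (_++ ⊥) (subsetsOf (inside ∷ D)) ∎
  where
  open ≡-Reasoning
  cons : ∀ s → map (s ∷_) (subsetsOf (D ++ ⊥)) ≡ map (_++ ⊥) (map (s ∷_) (subsetsOf D))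
  cons s = trans (cong (map (s ∷_)) (subsetsOf-++⊥ m D)) (map-∷-++ s (subsetsOf D) ⊥)

∣p++⊥∣≡∣p∣ : ∀ {k m} (p : Subset k) → ∣ p ++ ⊥ {m} ∣ ≡ ∣ p ∣
∣p++⊥∣≡∣p∣ {m = m} []  = ∣⊥∣≡0 m
∣p++⊥∣≡∣p∣ (outside ∷ p) = ∣p++⊥∣≡∣p∣ p
∣p++⊥∣≡∣p∣ (inside ∷ p)  = cong suc (∣p++⊥∣≡∣p∣ p)

module _ {A : Set} where

  suffixAfter : {x : A} {xs : List A} → x ∈ xs → List A
  suffixAfter (here {xs = xs} _) = xs
  suffixAfter (there x∈xs)       = suffixAfter x∈xs

  length-suffixAfter : {x : A} {xs : List A} (x∈xs : x ∈ xs) → length (suffixAfter x∈xs) < length xs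
  length-suffixAfter (here _)     = ≤-refl
  length-suffixAfter (there x∈xs) = m≤n⇒m≤1+n (length-suffixAfter x∈xs)

  Linked-suffixAfter : {R : A → A → Set} {x : A} {xs : List A} → Linked R xs →
                       (x∈xs : x ∈ xs) → Linked R (x ∷ suffixAfter x∈xs)
  Linked-suffixAfter lk (here refl)  = lk
  Linked-suffixAfter lk (there x∈xs) = Linked-suffixAfter (Linked.tail lk) x∈xs

  suffixAfter-head : {x : A} {xs : List A} (x∈xs : x ∈ xs) →
                     length xs ≡ suc (length (suffixAfter x∈xs)) → x ∷ suffixAfter x∈xs ≡ xs
  suffixAfter-head (here refl)  _ = refl
  suffixAfter-head (there x∈xs) e = contradiction (sym (suc-injective e)) (<⇒≢ (length-suffixAfter x∈xs))

module _ {k : ℕ} where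

  Linked⇒All-⊂ : {c : Subset k} {cs : List (Subset k)} → Linked _⊂_ (c ∷ cs) → All (c ⊂_) cs
  Linked⇒All-⊂ [-]        = []
  Linked⇒All-⊂ (c⊂d ∷ lk) = Linked⇒All ⊂-trans c⊂d lk

  ∈-suffixAfter : {x y : Subset k} {cs : List (Subset k)} → Linked _⊂_ cs →
                  (x∈cs : x ∈ cs) → y ∈ cs → x ⊆ y → y ∈ x ∷ suffixAfter x∈cs
  ∈-suffixAfter lk (here refl)  y∈cs        _   = y∈cs
  ∈-suffixAfter lk (there x∈cs) (here refl) x⊆y =
    ⊥-elim (⊂-irref refl (⊂-⊆-trans (All.lookup (Linked⇒All-⊂ lk) x∈cs) x⊆y))
  ∈-suffixAfter lk (there x∈cs) (there y∈cs) x⊆y = ∈-suffixAfter (Linked.tail lk) x∈cs y∈cs x⊆y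

  Linked-between : {a b : Subset k} (cs : List (Subset k)) → All (λ c → a ⊂ c × c ⊂ b) cs →
                   Linked _⊂_ cs → a ⊂ b → Linked _⊂_ (a ∷ cs List.++ b ∷ [])
  Linked-between []       []                   []  a⊂b = a⊂b ∷ [-]
  Linked-between (c ∷ cs) ((a⊂c , c⊂b) ∷ between) lk _ =
    a⊂c ∷ Linked-between cs (All.zip (Linked⇒All-⊂ lk , All.map proj₂ between)) (Linked.tail lk) c⊂b

Linked-bracket : ∀ {k} {ρ : RankFn (suc k)} {cs : List (Subset (suc k))} → IsChainOfFlats ρ cs →
                 Linked _⊂_ (⊥ ∷ cs List.++ ⊤ ∷ [])
Linked-bracket {cs = cs} (flats , lk) = Linked-between cs (All.map proj₂ flats) lk (⊥⊆ , zero , ∈⊤ , ∉⊥)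

-- Beta invariants of minors

betaMinor-coloop : ∀ {k} (ρ : RankFn k) {F G : Subset k} → F ⊆ G → ∣ G ─ F ∣ ≡ 1 →
                   ρ G ≡ suc (ρ F) → betaMinor ρ F G ≡ 1ℤ
betaMinor-coloop {k} ρ {F} {G} F⊆G ∣G─F∣≡1 ρG≡1+ρF
  rewrite subsetsOf-singleton (G ─ F) ∣G─F∣≡1 | ∣⊥∣≡0 k | ∪-identityˡ F | p⊆q⇒[q─p]∪p≡q F⊆G
        | ρG≡1+ρF | m+n∸n≡m 1 (ρ F) | ∣G─F∣≡1 = crapo (+ ρ F)
  where
  -- Crapo's sum over the subsets ∅ and G ─ F of the one-element minor.
  crapo : ∀ x → - 1ℤ * (1ℤ * (x - x) + (- 1ℤ * ((1ℤ + x) - x) + + 0)) ≡ 1ℤ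
  crapo = ℤ-Solver.solve-∀

-- Adding coloops

module _ {n : ℕ} (ρ : RankFn (suc n)) (m : ℕ) where

  private
    N = suc n

  withColoops-++ : (a : Subset N) (b : Subset m) → withColoops ρ m (a ++ b) ≡ ρ a +ℕ ∣ b ∣
  withColoops-++ a b = cong₂ (λ a′ b′ → ρ a′ +ℕ ∣ b′ ∣) (take-++ a b) (drop-++ a b)

  withColoops-⊤ : withColoops ρ m ⊤ ≡ ρ ⊤ +ℕ m
  withColoops-⊤ = trans (cong₂ (λ a b → ρ a +ℕ ∣ b ∣) (take-⊤ N) (drop-⊤ N)) (cong (ρ ⊤ +ℕ_) (∣⊤∣≡n m))

  betaMinor-withColoops-++ : (a b : Subset N) (s : Subset m) →
    betaMinor (withColoops ρ m) (a ++ s) (b ++ s) ≡ betaMinor ρ a b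
  betaMinor-withColoops-++ a b s = cong₂ _*_ sign sum
    where
    open ≡-Reasoning
    ρ′ = withColoops ρ m
    sign : sgn (ρ′ (b ++ s) ∸ ρ′ (a ++ s)) ≡ sgn (ρ b ∸ ρ a)
    sign = cong sgn (begin
      ρ′ (b ++ s) ∸ ρ′ (a ++ s)       ≡⟨ cong₂ _∸_ (withColoops-++ b s) (withColoops-++ a s) ⟩
      (ρ b +ℕ ∣ s ∣) ∸ (ρ a +ℕ ∣ s ∣) ≡⟨ cong₂ _∸_ (+-comm (ρ b) ∣ s ∣) (+-comm (ρ a) ∣ s ∣) ⟩
      (∣ s ∣ +ℕ ρ b) ∸ (∣ s ∣ +ℕ ρ a) ≡⟨ [m+n]∸[m+o]≡n∸o ∣ s ∣ (ρ b) (ρ a) ⟩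
      ρ b ∸ ρ a                       ∎)
    term′ term : Subset _ → ℤ
    term′ A = sgn ∣ A ∣ * (+ ρ′ (A ∪ (a ++ s)) - + ρ′ (a ++ s))
    term  A = sgn ∣ A ∣ * (+ ρ (A ∪ a) - + ρ a)
    term-++⊥ : ∀ A → term′ (A ++ ⊥) ≡ term A
    term-++⊥ A = cong₂ (λ c d → sgn c * d) (∣p++⊥∣≡∣p∣ A) (begin
      + ρ′ ((A ++ ⊥) ∪ (a ++ s)) - + ρ′ (a ++ s)
        ≡⟨ cong (λ X → + ρ′ X - + ρ′ (a ++ s)) (trans (zipWith-++ _ A ⊥ a s) (cong ((A ∪ a) ++_) (∪-identityˡ s))) ⟩
      + ρ′ ((A ∪ a) ++ s) - + ρ′ (a ++ s)
        ≡⟨ cong₂ (λ x y → + x - + y) (withColoops-++ (A ∪ a) s) (withColoops-++ a s) ⟩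
      + (ρ (A ∪ a) +ℕ ∣ s ∣) - + (ρ a +ℕ ∣ s ∣)
        ≡⟨ cong₂ _-_ (ℤ.pos-+ (ρ (A ∪ a)) ∣ s ∣) (ℤ.pos-+ (ρ a) ∣ s ∣) ⟩
      (+ ρ (A ∪ a) + + ∣ s ∣) - (+ ρ a + + ∣ s ∣)
        ≡⟨ cancel (+ ρ (A ∪ a)) (+ ρ a) (+ ∣ s ∣) ⟩
      + ρ (A ∪ a) - + ρ a ∎)
      where
      cancel : ∀ x y c → (x + c) - (y + c) ≡ x - y
      cancel = ℤ-Solver.solve-∀
    sum : sumℤ (map term′ (subsetsOf ((b ++ s) ─ (a ++ s)))) ≡ sumℤ (map term (subsetsOf (b ─ a)))
    sum = cong sumℤ (begin
      map term′ (subsetsOf ((b ++ s) ─ (a ++ s)))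
        ≡⟨ cong (map term′ ∘ subsetsOf) (trans (zipWith-++ _ b s a s) (cong ((b ─ a) ++_) (p─p≡⊥ s))) ⟩
      map term′ (subsetsOf ((b ─ a) ++ ⊥))         ≡⟨ cong (map term′) (subsetsOf-++⊥ m (b ─ a)) ⟩
      map term′ (map (_++ ⊥) (subsetsOf (b ─ a)))  ≡⟨ sym (map-∘ (subsetsOf (b ─ a))) ⟩
      map (term′ ∘ (_++ ⊥)) (subsetsOf (b ─ a))    ≡⟨ map-cong term-++⊥ (subsetsOf (b ─ a)) ⟩
      map term (subsetsOf (b ─ a))                 ∎)

  betaMinor-withColoops-flat : {F G : Subset (N +ℕ m)} → drop N F ≡ drop N G →
    betaMinor (withColoops ρ m) F G ≡ betaMinor ρ (take N F) (take N G)
  betaMinor-withColoops-flat {F} {G} dF≡dG = begin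
    betaMinor ρ′ F G
      ≡⟨ cong₂ (betaMinor ρ′) (sym (take++drop≡id N F))
               (trans (sym (take++drop≡id N G)) (cong (take N G ++_) (sym dF≡dG))) ⟩
    betaMinor ρ′ (take N F ++ drop N F) (take N G ++ drop N F)
      ≡⟨ betaMinor-withColoops-++ (take N F) (take N G) (drop N F) ⟩
    betaMinor ρ (take N F) (take N G) ∎
    where
    open ≡-Reasoning
    ρ′ = withColoops ρ m

  betaMinor-withColoops-coloop : {F G : Subset (N +ℕ m)} → F ⊆ G → take N F ≡ take N G →
    ∣ drop N G ∣ ≡ suc ∣ drop N F ∣ → betaMinor (withColoops ρ m) F G ≡ 1ℤ
  betaMinor-withColoops-coloop {F} {G} F⊆G tF≡tG ∣dG∣≡1+∣dF∣ =
    betaMinor-coloop (withColoops ρ m) F⊆G ∣G─F∣≡1 ρ′G≡1+ρ′F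
    where
    open ≡-Reasoning
    ρ′G≡1+ρ′F : ρ (take N G) +ℕ ∣ drop N G ∣ ≡ suc (ρ (take N F) +ℕ ∣ drop N F ∣)
    ρ′G≡1+ρ′F = trans (cong₂ _+ℕ_ (cong ρ (sym tF≡tG)) ∣dG∣≡1+∣dF∣) (+-suc _ _)
    ∣G∣≡1+∣F∣ : ∣ G ∣ ≡ suc ∣ F ∣
    ∣G∣≡1+∣F∣ = begin
      ∣ G ∣                             ≡⟨ sym (∣take∣+∣drop∣ N G) ⟩
      ∣ take N G ∣ +ℕ ∣ drop N G ∣      ≡⟨ cong₂ _+ℕ_ (cong ∣_∣ (sym tF≡tG)) ∣dG∣≡1+∣dF∣ ⟩
      ∣ take N F ∣ +ℕ suc ∣ drop N F ∣  ≡⟨ +-suc _ _ ⟩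
      suc (∣ take N F ∣ +ℕ ∣ drop N F ∣) ≡⟨ cong suc (∣take∣+∣drop∣ N F) ⟩
      suc ∣ F ∣                         ∎
    ∣G─F∣≡1 : ∣ G ─ F ∣ ≡ 1
    ∣G─F∣≡1 = +-cancelʳ-≡ ∣ F ∣ _ 1 (trans (p⊆q⇒∣q─p∣+∣p∣≡∣q∣ F⊆G) ∣G∣≡1+∣F∣)

  module _ {c : Subset N} {cs : List (Subset N)} (c∷cs↗ : Linked _⊂_ (c ∷ cs)) where

    traces-after : {G : Subset (N +ℕ m)} {Gs : List (Subset (N +ℕ m))} (tG∈cs : take N G ∈ cs) →
      Linked _⊂_ (G ∷ Gs) → All (λ G′ → take N G′ ∈ c ∷ cs) Gs →
      All (λ G′ → take N G′ ∈ take N G ∷ suffixAfter tG∈cs) Gs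
    traces-after tG∈cs G∷Gs↗ traces = All.zipWith
      (λ (G⊂G′ , tG′∈c∷cs) → ∈-suffixAfter c∷cs↗ (there tG∈cs) tG′∈c∷cs (take-⊆ N (p⊂q⇒p⊆q G⊂G′)))
      (Linked⇒All-⊂ G∷Gs↗ , traces)

  refinement-length : (c : Subset N) (cs : List (Subset N)) → Linked _⊂_ (c ∷ cs) →
    (F : Subset (N +ℕ m)) (Fs : List (Subset (N +ℕ m))) → Linked _⊂_ (F ∷ Fs) →
    take N F ≡ c → All (λ G → take N G ∈ c ∷ cs) Fs →
    length Fs +ℕ ∣ drop N F ∣ ≤ length cs +ℕ m
  refinement-length c cs _ F [] _ _ _ = ≤-trans (∣p∣≤n (drop N F)) (m≤n+m m (length cs))
  refinement-length c cs c∷cs↗ F (G ∷ Gs) (F⊂G ∷ G∷Gs↗) tF≡c (here tG≡c ∷ traces) = begin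
    suc (length Gs +ℕ ∣ drop N F ∣) ≡⟨ sym (+-suc (length Gs) _) ⟩
    length Gs +ℕ suc ∣ drop N F ∣   ≤⟨ +-monoʳ-≤ (length Gs) (take≡⇒⊂⇒∣drop∣<∣drop∣ N (trans tF≡c (sym tG≡c)) F⊂G) ⟩
    length Gs +ℕ ∣ drop N G ∣       ≤⟨ refinement-length c cs c∷cs↗ G Gs G∷Gs↗ tG≡c traces ⟩
    length cs +ℕ m                  ∎
    where open ≤-Reasoning
  refinement-length c cs c∷cs↗ F (G ∷ Gs) (F⊂G ∷ G∷Gs↗) tF≡c (there tG∈cs ∷ traces) = begin
    suc (length Gs +ℕ ∣ drop N F ∣)
      ≤⟨ s≤s (+-monoʳ-≤ (length Gs) (p⊆q⇒∣p∣≤∣q∣ (drop-⊆ N (p⊂q⇒p⊆q F⊂G)))) ⟩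
    suc (length Gs +ℕ ∣ drop N G ∣)
      ≤⟨ s≤s (refinement-length _ _ (Linked-suffixAfter c∷cs↗ (there tG∈cs)) G Gs G∷Gs↗ refl
                                (traces-after c∷cs↗ tG∈cs G∷Gs↗ traces)) ⟩
    suc (length (suffixAfter tG∈cs) +ℕ m)
      ≤⟨ +-monoˡ-≤ m (length-suffixAfter tG∈cs) ⟩
    length cs +ℕ m ∎
    where open ≤-Reasoning

  -- Equality forces every step to add exactly one coloop or to advance to the next
  -- member of c ∷ cs keeping the coloops.
  prodBeta-refinement : (c : Subset N) (cs : List (Subset N)) → Linked _⊂_ (c ∷ cs) →
    (F : Subset (N +ℕ m)) (Fs : List (Subset (N +ℕ m))) → Linked _⊂_ (F ∷ Fs) →
    take N F ≡ c → All (λ G → take N G ∈ c ∷ cs) Fs →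
    length Fs +ℕ ∣ drop N F ∣ ≡ length cs +ℕ m →
    prodBeta (withColoops ρ m) (F ∷ Fs) ≡ prodBeta ρ (c ∷ cs)
  prodBeta-refinement c []       _ F [] _ _ _ _     = refl
  prodBeta-refinement c (d ∷ ds) _ F [] _ _ _ tight =
    contradiction (subst (_≤ m) tight (∣p∣≤n (drop N F))) (<⇒≱ (s≤s (m≤n+m m (length ds))))
  prodBeta-refinement c cs c∷cs↗ F (G ∷ Gs) (F⊂G ∷ G∷Gs↗) tF≡c (here tG≡c ∷ traces) tight = begin
    betaMinor ρ′ F G * prodBeta ρ′ (G ∷ Gs)
      ≡⟨ cong₂ _*_ (betaMinor-withColoops-coloop (p⊂q⇒p⊆q F⊂G) tF≡tG ∣dG∣≡1+∣dF∣)
                   (prodBeta-refinement c cs c∷cs↗ G Gs G∷Gs↗ tG≡c traces (proj₂ squeeze)) ⟩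
    1ℤ * prodBeta ρ (c ∷ cs)
      ≡⟨ ℤ.*-identityˡ _ ⟩
    prodBeta ρ (c ∷ cs) ∎
    where
    open ≡-Reasoning
    ρ′ = withColoops ρ m
    tF≡tG : take N F ≡ take N G
    tF≡tG = trans tF≡c (sym tG≡c)
    step : suc (length Gs +ℕ ∣ drop N F ∣) ≤ length Gs +ℕ ∣ drop N G ∣
    step = ≤-trans (≤-reflexive (sym (+-suc _ _))) (+-monoʳ-≤ _ (take≡⇒⊂⇒∣drop∣<∣drop∣ N tF≡tG F⊂G))
    squeeze : suc (length Gs +ℕ ∣ drop N F ∣) ≡ length Gs +ℕ ∣ drop N G ∣ ×
              length Gs +ℕ ∣ drop N G ∣ ≡ length cs +ℕ m
    squeeze = ≤-squeeze step (refinement-length c cs c∷cs↗ G Gs G∷Gs↗ tG≡c traces) tight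
    ∣dG∣≡1+∣dF∣ : ∣ drop N G ∣ ≡ suc ∣ drop N F ∣
    ∣dG∣≡1+∣dF∣ = sym (+-cancelˡ-≡ (length Gs) _ _ (trans (+-suc _ _) (proj₁ squeeze)))
  prodBeta-refinement c cs c∷cs↗ F (G ∷ Gs) (F⊂G ∷ G∷Gs↗) tF≡c (there tG∈cs ∷ traces) tight = begin
    betaMinor ρ′ F G * prodBeta ρ′ (G ∷ Gs)
      ≡⟨ cong₂ _*_ (betaMinor-withColoops-flat {F} {G} dF≡dG)
                   (prodBeta-refinement _ _ suffix↗ G Gs G∷Gs↗ refl traces′ (suc-injective (proj₁ squeeze₂))) ⟩
    betaMinor ρ (take N F) (take N G) * prodBeta ρ (take N G ∷ suffixAfter tG∈cs)
      ≡⟨ cong (λ a → betaMinor ρ a (take N G) * prodBeta ρ (take N G ∷ suffixAfter tG∈cs)) tF≡c ⟩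
    prodBeta ρ (c ∷ take N G ∷ suffixAfter tG∈cs)
      ≡⟨ cong (prodBeta ρ ∘ (c ∷_)) (suffixAfter-head tG∈cs (sym (+-cancelʳ-≡ m _ _ (proj₂ squeeze₂)))) ⟩
    prodBeta ρ (c ∷ cs) ∎
    where
    open ≡-Reasoning
    ρ′ = withColoops ρ m
    suffix↗ : Linked _⊂_ (take N G ∷ suffixAfter tG∈cs)
    suffix↗ = Linked-suffixAfter c∷cs↗ (there tG∈cs)
    traces′ : All (λ G′ → take N G′ ∈ take N G ∷ suffixAfter tG∈cs) Gs
    traces′ = traces-after c∷cs↗ tG∈cs G∷Gs↗ traces
    dF⊆dG : drop N F ⊆ drop N G
    dF⊆dG = drop-⊆ N (p⊂q⇒p⊆q F⊂G)
    x≤y : suc (length Gs +ℕ ∣ drop N F ∣) ≤ suc (length Gs +ℕ ∣ drop N G ∣)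
    x≤y = s≤s (+-monoʳ-≤ (length Gs) (p⊆q⇒∣p∣≤∣q∣ dF⊆dG))
    y≤z : suc (length Gs +ℕ ∣ drop N G ∣) ≤ suc (length (suffixAfter tG∈cs) +ℕ m)
    y≤z = s≤s (refinement-length _ _ suffix↗ G Gs G∷Gs↗ refl traces′)
    z≤w : suc (length (suffixAfter tG∈cs) +ℕ m) ≤ length cs +ℕ m
    z≤w = +-monoˡ-≤ m (length-suffixAfter tG∈cs)
    squeeze₁ = ≤-squeeze x≤y (≤-trans y≤z z≤w) tight
    squeeze₂ = ≤-squeeze y≤z z≤w (proj₂ squeeze₁)
    dF≡dG : drop N F ≡ drop N G
    dF≡dG = p⊆q⇒∣p∣≡∣q∣⇒p≡q dF⊆dG (+-cancelˡ-≡ (length Gs) _ _ (suc-injective (proj₁ squeeze₁)))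

  prodBeta-fineCone : {σ : List (Subset N)} {τ : List (Subset (N +ℕ m))} →
    IsChainOfFlats ρ σ → FineConeIn ρ m σ τ →
    prodBeta (withColoops ρ m) (⊥ ∷ τ List.++ ⊤ ∷ []) ≡ prodBeta ρ (⊥ ∷ σ List.++ ⊤ ∷ [])
  prodBeta-fineCone {σ} {τ} σ-chain (τ-chain , ∣τ∣≡∣σ∣+m , τ-traces) =
    prodBeta-refinement ⊥ (σ List.++ ⊤ ∷ []) (Linked-bracket σ-chain)
                        ⊥ (τ List.++ ⊤ ∷ []) (Linked-bracket τ-chain) (take-⊥ N) traces tight
    where
    open ≡-Reasoning
    trace-∈ : {G : Subset (N +ℕ m)} → (take N G ≡ ⊥ ⊎ take N G ≡ ⊤) ⊎ take N G ∈ σ →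
              take N G ∈ ⊥ ∷ σ List.++ ⊤ ∷ []
    trace-∈ (inj₁ (inj₁ tG≡⊥)) = here tG≡⊥
    trace-∈ (inj₁ (inj₂ tG≡⊤)) = there (∈-++⁺ʳ σ (here tG≡⊤))
    trace-∈ (inj₂ tG∈σ)        = there (∈-++⁺ˡ tG∈σ)
    traces : All (λ G → take N G ∈ ⊥ ∷ σ List.++ ⊤ ∷ []) (τ List.++ ⊤ ∷ [])
    traces = All.++⁺ (All.map (λ {G} → trace-∈ {G}) τ-traces) (trace-∈ {⊤} (inj₁ (inj₂ (take-⊤ N))) ∷ [])
    tight : length (τ List.++ ⊤ ∷ []) +ℕ ∣ drop N (⊥ {N +ℕ m}) ∣ ≡ length (σ List.++ ⊤ ∷ []) +ℕ m
    tight = begin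
      length (τ List.++ ⊤ ∷ []) +ℕ ∣ drop N ⊥ ∣
        ≡⟨ cong₂ _+ℕ_ (length-++ τ) (trans (cong ∣_∣ (drop-⊥ N)) (∣⊥∣≡0 m)) ⟩
      length τ +ℕ 1 +ℕ 0    ≡⟨ cong (λ l → l +ℕ 1 +ℕ 0) ∣τ∣≡∣σ∣+m ⟩
      length σ +ℕ m +ℕ 1 +ℕ 0 ≡⟨ identity (length σ) m ⟩
      length σ +ℕ 1 +ℕ m    ≡⟨ cong (_+ℕ m) (sym (length-++ σ)) ⟩
      length (σ List.++ ⊤ ∷ []) +ℕ m ∎
      where
      identity : ∀ s m → s +ℕ m +ℕ 1 +ℕ 0 ≡ s +ℕ 1 +ℕ m
      identity = ℕ-Solver.solve-∀

  sgn-withColoops : {σ : List (Subset N)} {τ : List (Subset (N +ℕ m))} → 0 < ρ ⊤ →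
    length τ ≡ length σ +ℕ m →
    sgn ((withColoops ρ m ⊤ ∸ 1) +ℕ length τ) ≡ sgn ((ρ ⊤ ∸ 1) +ℕ length σ)
  sgn-withColoops {σ} {τ} 0<ρ⊤ ∣τ∣≡∣σ∣+m = begin
    sgn ((withColoops ρ m ⊤ ∸ 1) +ℕ length τ)
      ≡⟨ cong₂ (λ r l → sgn ((r ∸ 1) +ℕ l)) withColoops-⊤ ∣τ∣≡∣σ∣+m ⟩
    sgn ((ρ ⊤ +ℕ m ∸ 1) +ℕ (length σ +ℕ m))
      ≡⟨ cong (λ e → sgn (e +ℕ (length σ +ℕ m))) (+-∸-comm m 0<ρ⊤) ⟩
    sgn ((ρ ⊤ ∸ 1) +ℕ m +ℕ (length σ +ℕ m))
      ≡⟨ cong sgn (identity (ρ ⊤ ∸ 1) (length σ) m) ⟩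
    sgn (m +ℕ m +ℕ ((ρ ⊤ ∸ 1) +ℕ length σ))
      ≡⟨ sgn-double+ m _ ⟩
    sgn ((ρ ⊤ ∸ 1) +ℕ length σ) ∎
    where
    open ≡-Reasoning
    identity : ∀ d s m → d +ℕ m +ℕ (s +ℕ m) ≡ m +ℕ m +ℕ (d +ℕ s)
    identity = ℕ-Solver.solve-∀

  csmWeight-fineCone : {σ : List (Subset N)} {τ : List (Subset (N +ℕ m))} → 0 < ρ ⊤ →
    IsChainOfFlats ρ σ → FineConeIn ρ m σ τ → (k : ℤ) →
    csmWeight (withColoops ρ m) k τ ≡ csmWeight ρ (k - + m) σ
  csmWeight-fineCone {σ} {τ} 0<ρ⊤ σ-chain τ-cone@(_ , ∣τ∣≡∣σ∣+m , _) k
    with + length τ ℤ.≟ k | + length σ ℤ.≟ k - + m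
  ... | yes _     | yes _     = cong₂ _*_ (sgn-withColoops {σ} {τ} 0<ρ⊤ ∣τ∣≡∣σ∣+m) (prodBeta-fineCone σ-chain τ-cone)
  ... | no _      | no _      = refl
  ... | yes ∣τ∣≡k | no ∣σ∣≢k-m =
    contradiction (+[m+n]≡k⇒+m≡k-+n (subst (λ l → + l ≡ k) ∣τ∣≡∣σ∣+m ∣τ∣≡k)) ∣σ∣≢k-m
  ... | no ∣τ∣≢k  | yes ∣σ∣≡k-m =
    contradiction (subst (λ l → + l ≡ k) (sym ∣τ∣≡∣σ∣+m) (+m≡k-+n⇒+[m+n]≡k ∣σ∣≡k-m)) ∣τ∣≢k

rank-⊤-positive : ∀ {n} {ρ : RankFn (suc n)} → IsMatroid ρ → Loopless ρ → 0 < ρ ⊤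
rank-⊤-positive matroid loopless =
  ≤-trans (≤-reflexive (sym (loopless zero))) (IsMatroid.monotone matroid ⁅ zero ⁆ ⊤ ⊆⊤)

lemma3p13 : {n : ℕ} (ρ : RankFn (suc n)) → IsMatroid ρ → Loopless ρ →
    (r : ℕ) (σ : List (Subset (suc n))) → IsChainOfFlats ρ σ →
    (I J : Subset r) → I ⊆ J → (k : ℕ) →
    (τI : List (Subset (suc n +ℕ (r ∸ ∣ I ∣)))) → FineConeIn ρ (r ∸ ∣ I ∣) σ τI →
    (τJ : List (Subset (suc n +ℕ (r ∸ ∣ J ∣)))) → FineConeIn ρ (r ∸ ∣ J ∣) σ τJ →
    wCsmX ρ r (+ k) I τI ≡ wCsmX ρ r (+ k + + ∣ I ∣ - + ∣ J ∣) J τJ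
lemma3p13 ρ matroid loopless r σ σ-chain I J _ k τI τI-cone τJ τJ-cone = begin
  csmWeight (withColoops ρ (r ∸ ∣ I ∣)) (+ k) τI
    ≡⟨ csmWeight-fineCone ρ (r ∸ ∣ I ∣) 0<ρ⊤ σ-chain τI-cone (+ k) ⟩
  csmWeight ρ (+ k - + (r ∸ ∣ I ∣)) σ
    ≡⟨ cong (λ d → csmWeight ρ d σ) index ⟩
  csmWeight ρ (+ k + + ∣ I ∣ - + ∣ J ∣ - + (r ∸ ∣ J ∣)) σ
    ≡⟨ sym (csmWeight-fineCone ρ (r ∸ ∣ J ∣) 0<ρ⊤ σ-chain τJ-cone (+ k + + ∣ I ∣ - + ∣ J ∣)) ⟩
  csmWeight (withColoops ρ (r ∸ ∣ J ∣)) (+ k + + ∣ I ∣ - + ∣ J ∣) τJ ∎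
  where
  open ≡-Reasoning
  0<ρ⊤ : 0 < ρ ⊤
  0<ρ⊤ = rank-⊤-positive matroid loopless
  identity : ∀ k i j r → k - (r - i) ≡ k + i - j - (r - j)
  identity = ℤ-Solver.solve-∀
  -- Both indices are k + |I| - r.
  index : + k - + (r ∸ ∣ I ∣) ≡ + k + + ∣ I ∣ - + ∣ J ∣ - + (r ∸ ∣ J ∣)
  index rewrite +[m∸n]≡+m-+n (∣p∣≤n I) | +[m∸n]≡+m-+n (∣p∣≤n J) = identity (+ k) (+ ∣ I ∣) (+ ∣ J ∣) (+ r)
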